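{- Let $G=(V,E)$ be a graph, let $\mathbb{N}_1,\dots,\mathbb{N}_k$ be independent sets of $G$ forming a well-linked collection, and let $H$ be an embedding of $G$ with respect to them which is a threshold graph. Then for every pair $x,y$ of vertices which are nonadjacent in $G$ and satisfy $N_H(x) \subseteq N_H[y]$, we have $N_G(x) \subseteq N_G(y)$ if and only if $L(x) \geq L(y)$.
   Context: A graph is a threshold graph if it has no induced subgraph isomorphic to $P_4$, $C_4$ or $2K_2$. An embedding of $G$ with respect to independent sets $\mathbb{N}_1,\dots,\mathbb{N}_k$ is a graph $H=(V,F)$ with $E \subseteq F$ such that every edge of $F\setminus E$ has both endpoints in some $\mathbb{N}_i$. The collection is well-linked if for every $i$, every vertex $x \notin \mathbb{N}_i$ has a neighbor (in $G$) in $\mathbb{N}_i$. $N_G(x)$, $N_H(x)$ denote open neighborhoods in $G$, $H$, and $N_H[y]=N_H(y)\cup\{y\}$. The label $L(x)$ of a vertex $x$ is the $0/1$-vector of length $k$ whose $i$-th entry is $1$ iff $x \in \mathbb{N}_i$; $L(x) \geq L(y)$ means every entry of $L(x)$ is at least the corresponding entry of $L(y)$. -}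

module Defs where

open import Data.Nat using (ℕ)
open import Data.Fin using (Fin)
open import Data.Bool using (Bool; true; false) renaming (_≤_ to _≤ᵇ_)
open import Data.Vec using (Vec; tabulate; lookup)
open import Data.Vec.Relation.Binary.Pointwise.Inductive using (Pointwise)
open import Data.Product using (Σ; _×_; ∃)
open import Data.Sum using (_⊎_)
open import Relation.Nullary using (¬_)
open import Relation.Binary.PropositionalEquality using (_≡_)

record Graph (n : ℕ) : Set where
  field
    adj    : Fin n → Fin n → Bool
    sym    : ∀ x y → adj x y ≡ adj y x
    irrefl : ∀ x → adj x x ≡ false
open Graph public

Edge : ∀ {n} → Graph n → Fin n → Fin n → Set
Edge G x y = adj G x y ≡ true

NonEdge : ∀ {n} → Graph n → Fin n → Fin n → Set
NonEdge G x y = adj G x y ≡ false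

VSet : ℕ → Set
VSet n = Vec Bool n

_∈ᵥ_ : ∀ {n} → Fin n → VSet n → Set
x ∈ᵥ S = lookup S x ≡ true

_∉ᵥ_ : ∀ {n} → Fin n → VSet n → Set
x ∉ᵥ S = lookup S x ≡ false

Distinct4 : ∀ {n} → Fin n → Fin n → Fin n → Fin n → Set
Distinct4 a b c d =
  ¬ a ≡ b × ¬ a ≡ c × ¬ a ≡ d × ¬ b ≡ c × ¬ b ≡ d × ¬ c ≡ d

InducedP4 : ∀ {n} → Graph n → Fin n → Fin n → Fin n → Fin n → Set
InducedP4 G a b c d = Distinct4 a b c d ×
  Edge G a b × Edge G b c × Edge G c d ×
  NonEdge G a c × NonEdge G a d × NonEdge G b d

InducedC4 : ∀ {n} → Graph n → Fin n → Fin n → Fin n → Fin n → Set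
InducedC4 G a b c d = Distinct4 a b c d ×
  Edge G a b × Edge G b c × Edge G c d × Edge G d a ×
  NonEdge G a c × NonEdge G b d

Induced2K2 : ∀ {n} → Graph n → Fin n → Fin n → Fin n → Fin n → Set
Induced2K2 G a b c d = Distinct4 a b c d ×
  Edge G a b × Edge G c d ×
  NonEdge G a c × NonEdge G a d × NonEdge G b c × NonEdge G b d

IsThreshold : ∀ {n} → Graph n → Set
IsThreshold G = ∀ a b c d →
  ¬ InducedP4 G a b c d × ¬ InducedC4 G a b c d × ¬ Induced2K2 G a b c d

IsIndependent : ∀ {n} → Graph n → VSet n → Set
IsIndependent G S = ∀ x y → x ∈ᵥ S → y ∈ᵥ S → NonEdge G x y

WellLinked : ∀ {n k} → Graph n → (Fin k → VSet n) → Set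
WellLinked G N = ∀ i x → x ∉ᵥ N i → ∃ λ y → y ∈ᵥ N i × Edge G x y

IsEmbedding : ∀ {n k} → Graph n → (Fin k → VSet n) → Graph n → Set
IsEmbedding G N H =
  (∀ x y → Edge G x y → Edge H x y) ×
  (∀ x y → Edge H x y → NonEdge G x y → ∃ λ i → x ∈ᵥ N i × y ∈ᵥ N i)

NbhdSub : ∀ {n} → Graph n → Fin n → Fin n → Set
NbhdSub G x y = ∀ z → Edge G x z → Edge G y z

NbhdSubClosed : ∀ {n} → Graph n → Fin n → Fin n → Set
NbhdSubClosed G x y = ∀ z → Edge G x z → z ≡ y ⊎ Edge G y z

label : ∀ {n k} → (Fin k → VSet n) → Fin n → Vec Bool k
label N x = tabulate (λ i → lookup (N i) x)

_≥L_ : ∀ {k} → Vec Bool k → Vec Bool k → Set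
u ≥L v = Pointwise _≤ᵇ_ v u

-- Forward: if y ∈ Nᵢ but x ∉ Nᵢ, well-linkedness gives a neighbour w ∈ Nᵢ of x, which
-- by N_G(x) ⊆ N_G(y) is a neighbour of y inside the independent set Nᵢ.
-- Backward: a G-neighbour z of x is an H-neighbour of y (z ≠ y since xy ∉ E); were yz a
-- fill-in edge, y and z would share some Nᵢ, hence so would x and z, contradicting
-- independence.
module Submission where

open import Defs
open import Data.Fin using (Fin)
open import Data.Bool using (true; false; b≤b; f≤t) renaming (_≤_ to _≤ᵇ_)
open import Data.Vec using (lookup)
open import Data.Vec.Relation.Binary.Pointwise.Inductive using (tabulate⁺; tabulate⁻)
open import Data.Product using (_×_; _,_; ∃)
open import Data.Sum using (inj₁; inj₂)
open import Data.Empty using (⊥-elim)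
open import Relation.Nullary using (¬_)
open import Relation.Binary.PropositionalEquality using (_≡_; refl; trans) renaming (sym to ≡-sym)
open import Function.Bundles using (_⇔_; mk⇔; Equivalence)

≤ᵇ⇔⇒true : ∀ {b c} → (b ≤ᵇ c) ⇔ (b ≡ true → c ≡ true)
≤ᵇ⇔⇒true = mk⇔ to from
  where
  to : ∀ {b c} → b ≤ᵇ c → b ≡ true → c ≡ true
  to b≤b refl = refl
  from : ∀ {b c} → (b ≡ true → c ≡ true) → b ≤ᵇ c
  from {false} {false} _ = b≤b
  from {false} {true}  _ = f≤t
  from {true}          b⇒c with b⇒c refl
  ... | refl = b≤b

≥L⇔membership : ∀ {n k} (N : Fin k → VSet n) x y →
  (label N x ≥L label N y) ⇔ (∀ i → y ∈ᵥ N i → x ∈ᵥ N i)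
≥L⇔membership N x y = mk⇔
  (λ x≥y i → Equivalence.to ≤ᵇ⇔⇒true (tabulate⁻ x≥y i))
  (λ y⇒x → tabulate⁺ (λ i → Equivalence.from ≤ᵇ⇔⇒true (y⇒x i)))

module _ {n} (G : Graph n) where

  edge⇒¬nonEdge : ∀ {x y} → Edge G x y → ¬ NonEdge G x y
  edge⇒¬nonEdge e ne with trans (≡-sym e) ne
  ... | ()

  NbhdSub⇒∈ : ∀ {S x y} → IsIndependent G S →
    (x ∉ᵥ S → ∃ λ w → w ∈ᵥ S × Edge G x w) →
    NbhdSub G x y → y ∈ᵥ S → x ∈ᵥ S
  NbhdSub⇒∈ {S} {x} {y} indep linked sub y∈ with lookup S x
  ... | true  = refl
  ... | false with linked refl
  ...   | w , w∈ , xw = ⊥-elim (edge⇒¬nonEdge (sub w xw) (indep y w y∈ w∈))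

  membership⇒NbhdSub : ∀ {k} {N : Fin k → VSet n} {H : Graph n} →
    (∀ i → IsIndependent G (N i)) → IsEmbedding G N H →
    ∀ {x y} → NonEdge G x y → NbhdSubClosed H x y →
    (∀ i → y ∈ᵥ N i → x ∈ᵥ N i) → NbhdSub G x y
  membership⇒NbhdSub indep (G⊆H , fill-in) {x} {y} nxy cl y⇒x z xz
    with cl z (G⊆H x z xz)
  ... | inj₁ refl = ⊥-elim (edge⇒¬nonEdge xz nxy)
  ... | inj₂ yz with adj G y z in yz?
  ...   | true  = refl
  ...   | false with fill-in y z yz yz?
  ...     | i , y∈ , z∈ = ⊥-elim (edge⇒¬nonEdge xz (indep i x z (y⇒x i y∈) z∈))

mainTheorem10 : ∀ {n k} (G : Graph n) (N : Fin k → VSet n) (H : Graph n) →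
    (∀ i → IsIndependent G (N i)) → WellLinked G N →
    IsEmbedding G N H → IsThreshold H →
    ∀ x y → NonEdge G x y → NbhdSubClosed H x y →
    (NbhdSub G x y ⇔ (label N x ≥L label N y))
mainTheorem10 G N H indep linked emb _ x y nxy cl = mk⇔
  (λ sub → from (λ i → NbhdSub⇒∈ G {S = N i} (indep i) (linked i x) sub))
  (λ x≥y → membership⇒NbhdSub G {N = N} {H} indep emb nxy cl (to x≥y))
  where open Equivalence (≥L⇔membership N x y)
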